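{- For any simplicial complex $\Delta$ on $[n]$, $$\mathscr{F}^{\mathrm{root}}_{n,k}(\Delta)=\left\{(X,Y)\in\mathscr{F}^{\mathrm{rel}}_{n,k}(\Delta)\cap\big(\mathscr{C}_{n,k}(\Delta)\times\mathscr{C}_{n,k-1}(\Delta)\big):\beta_{k-1}(\Delta,Y)=0\right\}.$$
   Context: A $j$-face on $[n]$ is a subset of size $j+1$; a simplicial complex on $[n]$ is a nonempty family of subsets closed under taking subsets; $X_j$ is the set of $j$-faces of $X$, and $K_n^k$ the family of all subsets of $[n]$ of size at most $k+1$. For a complex $\Delta$, $\mathscr{C}_{n,k}(\Delta):=\{X: K_n^{k-1}\cap\Delta\subseteq X\subseteq K_n^k\cap\Delta\}$. Faces are oriented by the increasing order and $\partial$ is the oriented boundary matrix; for complexes $Y\subseteq X$, $\partial_i^{X/Y}:=\partial_{X_{i-1}\setminus Y_{i-1},X_i\setminus Y_i}$, $H_i(X,Y)$ is the homology of $(\mathbb{Z}^{X_i\setminus Y_i},\partial_i^{X/Y})$ and $\beta_i(X,Y)$ is the rank of its free part. $\mathscr{F}^{\mathrm{rel}}_{n,k}(\Delta)$ is the set of pairs $(X,Y)$ with $X\in\mathscr{C}_{n,k}(\Delta)$ and $Y\in\mathscr{C}_{n,j}(X)$ for some $j$, satisfying at least two of: $|X_k|-|Y_k|=\operatorname{rank}\partial_k^{\Delta/Y}$, $\beta_{k-1}(X,Y)=\beta_{k-1}(\Delta,Y)$, $\beta_k(X,Y)=0$. $\mathscr{F}^{\mathrm{root}}_{n,k}(\Delta)$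 is the set of pairs $(X,Y)\in\mathscr{C}_{n,k}(\Delta)\times\mathscr{C}_{n,k-1}(\Delta)$ satisfying at least two of: $|X_k|=|X_{k-1}\setminus Y_{k-1}|$, $\beta_{k-1}(X,Y)=0$, $\beta_k(X,Y)=0$. -}

module Defs where

open import Data.Bool using (Bool; true; false; _∧_; not; if_then_else_)
open import Data.Nat as ℕ using (ℕ; zero; suc; _<_; _≤_; _≡ᵇ_)
open import Data.Integer as ℤ using (ℤ; 0ℤ; 1ℤ)
open import Data.Fin using (Fin)
open import Data.Fin.Subset using (Subset; _⊆_; ∣_∣)
open import Data.Vec using (Vec; []; _∷_)
open import Data.Vec.Properties using (≡-dec)
open import Data.List using (List; []; _∷_; _++_; map; filter; length)
open import Data.List.Membership.Propositional using (_∈_)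
open import Data.Product using (Σ; ∃; _×_)
open import Data.Sum using (_⊎_)
open import Relation.Nullary using (¬_; does)
open import Relation.Unary using (Decidable)
open import Relation.Binary.PropositionalEquality using (_≡_)
import Data.Bool.Properties as BoolP

-- A face of dimension j
-- has size j+1.  Throughout we index by SIZE s = j+1 (a natural number), so
-- that dimension -1 (the empty face) is size 0.

Family : ℕ → Set
Family n = Subset n → Bool

allSubsets : (n : ℕ) → List (Subset n)
allSubsets zero = [] ∷ []
allSubsets (suc n) = map (false ∷_) (allSubsets n) ++ map (true ∷_) (allSubsets n)

IsSimplicialComplex : {n : ℕ} → Family n → Set
IsSimplicialComplex {n} Δ =
  (∃ λ σ → Δ σ ≡ true) × (∀ σ τ → τ ⊆ σ → Δ σ ≡ true → Δ τ ≡ true)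

-- C_{n,j}(Δ) with t = j+1:  K^{j-1} ∩ Δ ⊆ X ⊆ K^j ∩ Δ
InC : {n : ℕ} → ℕ → Family n → Family n → Set
InC {n} t Δ X = ∀ (σ : Subset n) →
  (Δ σ ≡ true → ∣ σ ∣ < t → X σ ≡ true) × (X σ ≡ true → (Δ σ ≡ true) × (∣ σ ∣ ≤ t))

relFaces : {n : ℕ} → Family n → Family n → ℕ → List (Subset n)
relFaces {n} X Y s = filter P (allSubsets n)
  where
  P : Decidable (λ σ → (X σ ∧ not (Y σ) ∧ (∣ σ ∣ ≡ᵇ s)) ≡ true)
  P σ = (X σ ∧ not (Y σ) ∧ (∣ σ ∣ ≡ᵇ s)) BoolP.≟ true

faces : {n : ℕ} → Family n → ℕ → List (Subset n)
faces X s = relFaces X (λ _ → false) s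

-- row index set of ∂ on chains of size-s faces: faces of size s-1 (none if s = 0)
rowFaces : {n : ℕ} → Family n → Family n → ℕ → List (Subset n)
rowFaces X Y zero = []
rowFaces X Y (suc s) = relFaces X Y s

-- incidence coefficient [σ : τ] of the oriented boundary (faces oriented by
-- increasing order): (-1)^p if σ = τ ∪ {v}, v ∉ τ, p = #{u ∈ σ : u < v}; else 0
inc : {n : ℕ} → Subset n → Subset n → ℤ
inc [] [] = 0ℤ
inc (true ∷ τ) (true ∷ σ) = ℤ.- inc τ σ
inc (false ∷ τ) (false ∷ σ) = inc τ σ
inc (false ∷ τ) (true ∷ σ) = if does (≡-dec BoolP._≟_ τ σ) then 1ℤ else 0ℤ
inc (true ∷ τ) (false ∷ σ) = 0ℤ

-- integer chains (only the values on the relevant face list matter)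
Chain : ℕ → Set
Chain n = Subset n → ℤ

sumList : {n : ℕ} → List (Subset n) → (Subset n → ℤ) → ℤ
sumList [] f = 0ℤ
sumList (x ∷ xs) f = f x ℤ.+ sumList xs f

sumFin : (b : ℕ) → (Fin b → ℤ) → ℤ
sumFin zero f = 0ℤ
sumFin (suc b) f = f Fin.zero ℤ.+ sumFin b (λ j → f (Fin.suc j))
  where import Data.Fin as Fin

-- relative boundary ∂^{X/Y} applied to a chain on size-s faces of X∖Y,
-- evaluated at a face τ (of size s-1)
bd : {n : ℕ} → Family n → Family n → ℕ → Chain n → Chain n
bd X Y s w τ = sumList (relFaces X Y s) (λ σ → inc τ σ ℤ.* w σ)

lincomb : {n b : ℕ} → (Fin b → ℤ) → (Fin b → Chain n) → Chain n
lincomb {b = b} c z σ = sumFin b (λ j → c j ℤ.* z j σ)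

EqOn : {n : ℕ} → List (Subset n) → Chain n → Chain n → Set
EqOn L f g = ∀ σ → σ ∈ L → f σ ≡ g σ

-- rank of the boundary matrix ∂_s^{X/Y} (columns: size-s faces of X∖Y),
-- i.e. maximal number of Z-linearly independent elements of its image
IndepIm : {n : ℕ} → Family n → Family n → ℕ → (r : ℕ) → (Fin r → Chain n) → Set
IndepIm X Y s r w = ∀ (c : Fin r → ℤ) →
  EqOn (rowFaces X Y s) (lincomb c (λ j → bd X Y s (w j))) (λ _ → 0ℤ) →
  ∀ j → c j ≡ 0ℤ

HasRank : {n : ℕ} → Family n → Family n → ℕ → ℕ → Set
HasRank {n} X Y s r =
  (Σ (Fin r → Chain n) λ w → IndepIm X Y s r w) ×
  (∀ (w : Fin (suc r) → Chain n) → ¬ IndepIm X Y s (suc r) w)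

-- Betti number β_{s-1}(X,Y): rank of (the free part of) the homology group
-- H_{s-1}(X,Y) = ker ∂_{s-1} / im ∂_s, i.e. maximal number of cycles that are
-- Z-independent modulo boundaries
IsCycle : {n : ℕ} → Family n → Family n → ℕ → Chain n → Set
IsCycle X Y s z = EqOn (rowFaces X Y s) (bd X Y s z) (λ _ → 0ℤ)

IndepH : {n : ℕ} → Family n → Family n → ℕ → (b : ℕ) → (Fin b → Chain n) → Set
IndepH {n} X Y s b z = ∀ (c : Fin b → ℤ) (w : Chain n) →
  EqOn (relFaces X Y s) (lincomb c z) (bd X Y (suc s) w) →
  ∀ j → c j ≡ 0ℤ

HasBetti : {n : ℕ} → Family n → Family n → ℕ → ℕ → Set
HasBetti {n} X Y s b =
  (Σ (Fin b → Chain n) λ z → (∀ j → IsCycle X Y s (z j)) × IndepH X Y s b z) ×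
  (∀ (z : Fin (suc b) → Chain n) → (∀ j → IsCycle X Y s (z j)) →
     ¬ IndepH X Y s (suc b) z)

AtLeastTwo : Set → Set → Set → Set
AtLeastTwo P Q R = (P × Q) ⊎ (P × R) ⊎ (Q × R)

-- F^rel_{n,k}(Δ)   (k-faces have size suc k, (k-1)-faces size k)
Frel : {n : ℕ} → ℕ → Family n → Family n → Family n → Set
Frel k Δ X Y =
  InC (suc k) Δ X × (∃ λ t → InC t X Y) ×
  AtLeastTwo
    (∃ λ r → HasRank Δ Y (suc k) r × (length (faces X (suc k)) ≡ length (faces Y (suc k)) ℕ.+ r))
    (∃ λ b → HasBetti X Y k b × HasBetti Δ Y k b)
    (HasBetti X Y (suc k) 0)

Froot : {n : ℕ} → ℕ → Family n → Family n → Family n → Set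
Froot k Δ X Y =
  InC (suc k) Δ X × InC k Δ Y ×
  AtLeastTwo
    (length (faces X (suc k)) ≡ length (relFaces X Y k))
    (HasBetti X Y k 0)
    (HasBetti X Y (suc k) 0)

-- For X ∈ C_{n,k}(Δ) and Y ∈ C_{n,k-1}(Δ) the pair (X, Y) has relative faces only in
-- dimensions k and k-1, and its (k-1)-faces are those of (Δ, Y).  Everything is thus about
-- one boundary map ∂ : ℤ^{X_k} → ℤ^{X_{k-1} ∖ Y_{k-1}}: β_k(X,Y) = 0 says ∂ is injective,
-- β_{k-1}(X,Y) = 0 says its cokernel is torsion, and then the same holds for ∂^{Δ/Y}, whose
-- image is larger.  When |X_k| = |X_{k-1} ∖ Y_{k-1}| the map is square, and by the Steinitz
-- exchange bound each of the two properties implies the other.  Conversely, β_{k-1}(Δ,Y) = 0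
-- makes rank ∂^{Δ/Y} = |X_{k-1} ∖ Y_{k-1}| and β_{k-1}(X,Y) = β_{k-1}(Δ,Y) = 0, which turns
-- the conditions of F^rel into those of F^root.

module Submission where

open import Defs
open import Data.Bool using (Bool; true; false; _∧_; not; if_then_else_; T)
import Data.Bool.Properties as BoolP
open import Data.Nat as ℕ using (ℕ; zero; suc; _≤_; z≤n; s≤s)
import Data.Nat.Properties as ℕP
open import Data.Integer as ℤ using (ℤ; 0ℤ; 1ℤ; _*_; _+_; -_; _-_)
import Data.Integer.Properties as ℤP
open import Data.Integer.Tactic.RingSolver using (solve-∀)
open import Data.Fin as F using (Fin; punchIn)
import Data.Fin.Properties as FP
open import Data.Fin.Subset using (Subset; ∣_∣)
open import Data.List using (List; []; _∷_; _++_; length; lookup; filter; map)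
import Data.List.Properties as LP
open import Data.List.Membership.Propositional using (_∈_)
open import Data.List.Membership.Propositional.Properties using (∈-lookup; ∈-map⁻; ∈-∃++; ∈-++⁻; ∈-++⁺ˡ; ∈-++⁺ʳ)
open import Data.List.Relation.Unary.Any using (here; there)
import Data.List.Relation.Unary.All as All
open import Data.List.Relation.Unary.AllPairs using ([]; _∷_)
open import Data.List.Relation.Unary.Unique.Propositional using (Unique)
import Data.List.Relation.Unary.Unique.Propositional.Properties as UniqueP
open import Data.Vec using ([]; _∷_)
open import Data.Vec.Properties using (≡-dec; ∷-injective)
open import Data.Vec.Functional using (insertAt)
open import Data.Vec.Functional.Properties using (insertAt-lookup; insertAt-punchIn)
open import Data.Product using (Σ; ∃; _×_; _,_; proj₁; proj₂)
open import Data.Sum using (inj₁; inj₂)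
open import Data.Empty using (⊥; ⊥-elim)
open import Function.Bundles using (_⇔_; mk⇔)
open import Relation.Nullary using (¬_; yes; no; does; ¬?)
open import Relation.Nullary.Decidable using (decidable-stable)
open import Relation.Binary.PropositionalEquality

sumFin-cong : ∀ b {f g : Fin b → ℤ} → (∀ j → f j ≡ g j) → sumFin b f ≡ sumFin b g
sumFin-cong zero    f≗g = refl
sumFin-cong (suc b) f≗g = cong₂ _+_ (f≗g F.zero) (sumFin-cong b (λ j → f≗g (F.suc j)))

sumFin-zero : ∀ b {f : Fin b → ℤ} → (∀ j → f j ≡ 0ℤ) → sumFin b f ≡ 0ℤ
sumFin-zero zero    f≗0 = refl
sumFin-zero (suc b) f≗0 = cong₂ _+_ (f≗0 F.zero) (sumFin-zero b (λ j → f≗0 (F.suc j)))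

sumFin-+ : ∀ b (f g : Fin b → ℤ) → sumFin b (λ j → f j + g j) ≡ sumFin b f + sumFin b g
sumFin-+ zero    f g = refl
sumFin-+ (suc b) f g rewrite sumFin-+ b (λ j → f (F.suc j)) (λ j → g (F.suc j)) =
  interchange (f F.zero) (g F.zero) _ _
  where
  interchange : ∀ a b c d → (a + b) + (c + d) ≡ (a + c) + (b + d)
  interchange = solve-∀

sumFin-*ˡ : ∀ b (a : ℤ) (f : Fin b → ℤ) → sumFin b (λ j → a * f j) ≡ a * sumFin b f
sumFin-*ˡ zero    a f = sym (ℤP.*-zeroʳ a)
sumFin-*ˡ (suc b) a f rewrite sumFin-*ˡ b a (λ j → f (F.suc j)) =
  sym (ℤP.*-distribˡ-+ a (f F.zero) _)

sumFin-punchIn : ∀ q (j₀ : Fin (suc q)) (f : Fin (suc q) → ℤ) →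
  sumFin (suc q) f ≡ f j₀ + sumFin q (λ i → f (punchIn j₀ i))
sumFin-punchIn q       F.zero     f = refl
sumFin-punchIn (suc q) (F.suc j₀) f rewrite sumFin-punchIn q j₀ (λ j → f (F.suc j)) =
  left-comm (f F.zero) (f (F.suc j₀)) _
  where
  left-comm : ∀ a b c → a + (b + c) ≡ b + (a + c)
  left-comm = solve-∀

sumFin-select : ∀ b (g δ : Fin b → ℤ) (j : Fin b) → δ j ≡ 1ℤ →
  (∀ i → i ≢ j → δ i ≡ 0ℤ) → sumFin b (λ i → g i * δ i) ≡ g j
sumFin-select (suc b) g δ j δj≡1 δi≡0 = begin
  sumFin (suc b) (λ i → g i * δ i)
    ≡⟨ sumFin-punchIn b j (λ i → g i * δ i) ⟩
  g j * δ j + sumFin b (λ i → g (punchIn j i) * δ (punchIn j i))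
    ≡⟨ cong₂ _+_ (cong (g j *_) δj≡1) (sumFin-zero b vanish) ⟩
  g j * 1ℤ + 0ℤ
    ≡⟨ trans (ℤP.+-identityʳ _) (ℤP.*-identityʳ _) ⟩
  g j ∎
  where
  open ≡-Reasoning
  vanish : ∀ i → g (punchIn j i) * δ (punchIn j i) ≡ 0ℤ
  vanish i = trans (cong (g (punchIn j i) *_) (δi≡0 (punchIn j i) (FP.punchInᵢ≢i j i)))
                   (ℤP.*-zeroʳ (g (punchIn j i)))

sumList-cong : ∀ {n} (L : List (Subset n)) {f g : Subset n → ℤ} →
  EqOn L f g → sumList L f ≡ sumList L g
sumList-cong []      f≗g = refl
sumList-cong (x ∷ L) f≗g = cong₂ _+_ (f≗g x (here refl)) (sumList-cong L (λ y y∈L → f≗g y (there y∈L)))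

sumList-zero : ∀ {n} (L : List (Subset n)) {f : Subset n → ℤ} →
  EqOn L f (λ _ → 0ℤ) → sumList L f ≡ 0ℤ
sumList-zero []      f≗0 = refl
sumList-zero (x ∷ L) f≗0 = cong₂ _+_ (f≗0 x (here refl)) (sumList-zero L (λ y y∈L → f≗0 y (there y∈L)))

sumList-+ : ∀ {n} (L : List (Subset n)) (f g : Subset n → ℤ) →
  sumList L (λ x → f x + g x) ≡ sumList L f + sumList L g
sumList-+ []      f g = refl
sumList-+ (x ∷ L) f g rewrite sumList-+ L f g = interchange (f x) (g x) _ _
  where
  interchange : ∀ a b c d → (a + b) + (c + d) ≡ (a + c) + (b + d)
  interchange = solve-∀

sumList-*ˡ : ∀ {n} (L : List (Subset n)) (a : ℤ) (f : Subset n → ℤ) →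
  sumList L (λ x → a * f x) ≡ a * sumList L f
sumList-*ˡ []      a f = sym (ℤP.*-zeroʳ a)
sumList-*ˡ (x ∷ L) a f rewrite sumList-*ˡ L a f = sym (ℤP.*-distribˡ-+ a (f x) _)

sumFin-sumList-comm : ∀ {n} b (L : List (Subset n)) (f : Fin b → Subset n → ℤ) →
  sumFin b (λ j → sumList L (f j)) ≡ sumList L (λ x → sumFin b (λ j → f j x))
sumFin-sumList-comm zero    L f = sym (sumList-zero L (λ _ _ → refl))
sumFin-sumList-comm (suc b) L f rewrite sumFin-sumList-comm b L (λ j → f (F.suc j)) =
  sym (sumList-+ L (f F.zero) _)

sumList-filter : ∀ {n} (p : Subset n → Bool) (g : Subset n → ℤ) L →
  sumList (filter (λ σ → p σ BoolP.≟ true) L) g ≡ sumList L (λ σ → if p σ then g σ else 0ℤ)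
sumList-filter p g []      = refl
sumList-filter p g (x ∷ L) with p x
... | true  = cong (g x +_) (sumList-filter p g L)
... | false = trans (sumList-filter p g L) (sym (ℤP.+-identityˡ _))

i*j≡0⇒i≡0 : ∀ i j → i * j ≡ 0ℤ → j ≢ 0ℤ → i ≡ 0ℤ
i*j≡0⇒i≡0 i j ij≡0 j≢0 with ℤP.i*j≡0⇒i≡0∨j≡0 i ij≡0
... | inj₁ i≡0 = i≡0
... | inj₂ j≡0 = ⊥-elim (j≢0 j≡0)

Independent : ∀ {n} → List (Subset n) → (q : ℕ) → (Fin q → Chain n) → Set
Independent L q v = ∀ c → EqOn L (lincomb c v) (λ _ → 0ℤ) → ∀ j → c j ≡ 0ℤ

independent-dropZeroRow : ∀ {n} (L₁ L₂ : List (Subset n)) {a : Subset n} {q v} →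
  (∀ j → v j a ≡ 0ℤ) → Independent (L₁ ++ a ∷ L₂) q v → Independent (L₁ ++ L₂) q v
independent-dropZeroRow L₁ L₂ {a} {q} {v} va≡0 ind c c·v≡0 = ind c c·v≡0′
  where
  c·v≡0′ : EqOn (L₁ ++ a ∷ L₂) (lincomb c v) (λ _ → 0ℤ)
  c·v≡0′ σ σ∈ with ∈-++⁻ L₁ σ∈
  ... | inj₁ σ∈L₁         = c·v≡0 σ (∈-++⁺ˡ σ∈L₁)
  ... | inj₂ (here refl)  = sumFin-zero q (λ j → trans (cong (c j *_) (va≡0 j)) (ℤP.*-zeroʳ (c j)))
  ... | inj₂ (there σ∈L₂) = c·v≡0 σ (∈-++⁺ʳ L₁ σ∈L₂)

-- Gaussian elimination of the row a with pivot v j₀ a.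
eliminate : ∀ {n q} → (Fin (suc q) → Chain n) → Fin (suc q) → Subset n → Fin q → Chain n
eliminate v j₀ a i σ = v j₀ a * v (punchIn j₀ i) σ - v (punchIn j₀ i) a * v j₀ σ

independent-eliminate : ∀ {n} {a : Subset n} {L q} {v : Fin (suc q) → Chain n} (j₀ : Fin (suc q)) →
  v j₀ a ≢ 0ℤ → Independent (a ∷ L) (suc q) v → Independent L q (eliminate v j₀ a)
independent-eliminate {a = a} {L} {q} {v} j₀ α≢0 ind d d·w≡0 i =
  i*j≡0⇒i≡0 (d i) α (trans (ℤP.*-comm (d i) α) α·dᵢ≡0) α≢0
  where
  open ≡-Reasoning
  α = v j₀ a
  β : Fin q → ℤ
  β i = v (punchIn j₀ i) a
  S = sumFin q (λ i → d i * β i)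
  c : Fin (suc q) → ℤ
  c = insertAt (λ i → α * d i) j₀ (- S)

  c·v≡d·w : ∀ σ → lincomb c v σ ≡ lincomb d (eliminate v j₀ a) σ
  c·v≡d·w σ = begin
    lincomb c v σ
      ≡⟨ sumFin-punchIn q j₀ (λ j → c j * v j σ) ⟩
    c j₀ * y + sumFin q (λ i → c (punchIn j₀ i) * x i)
      ≡⟨ cong₂ (λ u t → u * y + t) (insertAt-lookup _ j₀ (- S))
           (sumFin-cong q (λ i → cong (_* x i) (insertAt-punchIn _ j₀ (- S) i))) ⟩
    (- S) * y + rest
      ≡⟨ move S y rest ⟩
    rest + (- y) * S
      ≡⟨ cong (rest +_) (sym (sumFin-*ˡ q (- y) (λ i → d i * β i))) ⟩
    rest + sumFin q (λ i → (- y) * (d i * β i))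
      ≡⟨ sym (sumFin-+ q _ _) ⟩
    sumFin q (λ i → α * d i * x i + (- y) * (d i * β i))
      ≡⟨ sumFin-cong q (λ i → factor (d i) α (x i) (β i) y) ⟩
    lincomb d (eliminate v j₀ a) σ ∎
    where
    x : Fin q → ℤ
    x i = v (punchIn j₀ i) σ
    y = v j₀ σ
    rest = sumFin q (λ i → α * d i * x i)
    move : ∀ s y t → (- s) * y + t ≡ t + (- y) * s
    move = solve-∀
    factor : ∀ d α x β y → α * d * x + (- y) * (d * β) ≡ d * (α * x - β * y)
    factor = solve-∀

  d·w-vanishes-at-a : lincomb d (eliminate v j₀ a) a ≡ 0ℤ
  d·w-vanishes-at-a = sumFin-zero q (λ i → cancel (d i) α (β i))
    where
    cancel : ∀ d α β → d * (α * β - β * α) ≡ 0ℤ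
    cancel = solve-∀

  c≡0 : ∀ j → c j ≡ 0ℤ
  c≡0 = ind c λ
    { σ (here refl) → trans (c·v≡d·w a) d·w-vanishes-at-a
    ; σ (there σ∈L) → trans (c·v≡d·w σ) (d·w≡0 σ σ∈L) }

  α·dᵢ≡0 : α * d i ≡ 0ℤ
  α·dᵢ≡0 = trans (sym (insertAt-punchIn _ j₀ (- S) i)) (c≡0 (punchIn j₀ i))

-- Steinitz exchange bound, by Gaussian elimination along the coordinates in L.
independent⇒≤length : ∀ {n} (L : List (Subset n)) q (v : Fin q → Chain n) →
  Independent L q v → q ≤ length L
independent⇒≤length L       zero    v ind = z≤n
independent⇒≤length []      (suc q) v ind with () ← ind (λ _ → 1ℤ) (λ σ ()) F.zero
independent⇒≤length (a ∷ L) (suc q) v ind with FP.any? (λ j → ¬? (v j a ℤ.≟ 0ℤ))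
... | yes (j₀ , α≢0) = s≤s (independent⇒≤length L q _ (independent-eliminate {v = v} j₀ α≢0 ind))
... | no  noPivot    = ℕP.m≤n⇒m≤1+n (independent⇒≤length L (suc q) v
  (independent-dropZeroRow [] L {v = v} (λ j → decidable-stable (v j a ℤ.≟ 0ℤ) (λ ne → noPivot (j , ne))) ind))

lookup-injective : ∀ {A : Set} {L : List A} → Unique L → ∀ i j → lookup L i ≡ lookup L j → i ≡ j
lookup-injective (_ ∷ _)  F.zero    F.zero    _ = refl
lookup-injective (x∉ ∷ _) F.zero    (F.suc j) e = ⊥-elim (All.lookup x∉ (∈-lookup j) e)
lookup-injective (x∉ ∷ _) (F.suc i) F.zero    e = ⊥-elim (All.lookup x∉ (∈-lookup i) (sym e))
lookup-injective (_ ∷ u)  (F.suc i) (F.suc j) e = cong F.suc (lookup-injective u i j e)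

indicator : ∀ {n} → Subset n → Chain n
indicator σ τ = if does (≡-dec BoolP._≟_ τ σ) then 1ℤ else 0ℤ

indicator-self : ∀ {n} (σ : Subset n) → indicator σ σ ≡ 1ℤ
indicator-self σ with ≡-dec BoolP._≟_ σ σ
... | yes _   = refl
... | no σ≢σ = ⊥-elim (σ≢σ refl)

indicator-other : ∀ {n} {σ τ : Subset n} → τ ≢ σ → indicator σ τ ≡ 0ℤ
indicator-other {σ = σ} {τ} τ≢σ with ≡-dec BoolP._≟_ τ σ
... | yes τ≡σ = ⊥-elim (τ≢σ τ≡σ)
... | no _    = refl

lincomb-indicators : ∀ {n q} (τ : Fin q → Subset n) → (∀ i j → τ i ≡ τ j → i ≡ j) →
  (c : Fin q → ℤ) → ∀ j → lincomb c (λ i → indicator (τ i)) (τ j) ≡ c j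
lincomb-indicators {q = q} τ τ-inj c j =
  sumFin-select q c (λ i → indicator (τ i) (τ j)) j (indicator-self (τ j))
    (λ i i≢j → indicator-other (λ τj≡τi → i≢j (τ-inj i j (sym τj≡τi))))

scaledIndicators-independent : ∀ {n} (L : List (Subset n)) q (τ : Fin q → Subset n) →
  (∀ i j → τ i ≡ τ j → i ≡ j) → (∀ i → τ i ∈ L) →
  (a : Fin q → ℤ) → (∀ i → a i ≢ 0ℤ) →
  (u : Fin q → Chain n) → (∀ i → EqOn L (u i) (λ σ → a i * indicator (τ i) σ)) →
  Independent L q u
scaledIndicators-independent L q τ τ-inj τ∈L a a≢0 u u≡a·τ d d·u≡0 j =
  i*j≡0⇒i≡0 (d j) (a j) dⱼaⱼ≡0 (a≢0 j)
  where
  open ≡-Reasoning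
  dⱼaⱼ≡0 : d j * a j ≡ 0ℤ
  dⱼaⱼ≡0 = begin
    d j * a j
      ≡⟨ lincomb-indicators τ τ-inj (λ i → d i * a i) j ⟨
    lincomb (λ i → d i * a i) (λ i → indicator (τ i)) (τ j)
      ≡⟨ sumFin-cong q (λ i → trans (ℤP.*-assoc (d i) (a i) _) (cong (d i *_) (sym (u≡a·τ i (τ j) (τ∈L j))))) ⟩
    lincomb d u (τ j)
      ≡⟨ d·u≡0 (τ j) (τ∈L j) ⟩
    0ℤ ∎

¬¬-finChoice : ∀ q {P : Fin q → Set} → (∀ i → ¬ ¬ P i) → ¬ ¬ (∀ i → P i)
¬¬-finChoice zero    ¬¬P ¬∀P = ¬∀P (λ ())
¬¬-finChoice (suc q) ¬¬P ¬∀P = ¬¬P F.zero λ P₀ → ¬¬-finChoice q (λ i → ¬¬P (F.suc i))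
  λ P₊ → ¬∀P λ { F.zero → P₀ ; (F.suc i) → P₊ i }

module LinearMap {n} (C R : List (Subset n)) (C-unique : Unique C) (R-unique : Unique R)
  (f : Chain n → Chain n)
  (f-cong : ∀ {x y} → EqOn C x y → ∀ τ → f x τ ≡ f y τ)
  (f-lincomb : ∀ {b} (c : Fin b → ℤ) (z : Fin b → Chain n) τ →
    f (lincomb c z) τ ≡ lincomb c (λ j → f (z j)) τ)
  where

  TrivialKernel : Set
  TrivialKernel = ∀ x → EqOn R (f x) (λ _ → 0ℤ) → EqOn C x (λ _ → 0ℤ)

  -- Double-negated ("some nonzero multiple of z lies in the image"), as HasBetti provides it.
  TorsionCokernel : Set
  TorsionCokernel = ∀ (z : Chain n) → ¬ (∀ c w → EqOn R (λ σ → c * z σ) (f w) → c ≡ 0ℤ)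

  f-zero : ∀ τ → f (λ _ → 0ℤ) τ ≡ 0ℤ
  f-zero = f-lincomb {0} (λ ()) (λ ())

  f-difference : ∀ a β x y τ → f (λ σ → a * x σ - β * y σ) τ ≡ a * f x τ - β * f y τ
  f-difference a β x y τ = begin
    f (λ σ → a * x σ - β * y σ) τ  ≡⟨ f-cong (λ σ _ → sym (unfold a β (x σ) (y σ))) τ ⟩
    f (lincomb c z) τ              ≡⟨ f-lincomb c z τ ⟩
    lincomb c (λ j → f (z j)) τ    ≡⟨ unfold a β (f x τ) (f y τ) ⟩
    a * f x τ - β * f y τ          ∎
    where
    open ≡-Reasoning
    c : Fin 2 → ℤ
    c = λ { F.zero → a ; (F.suc _) → - β }
    z : Fin 2 → Chain n
    z = λ { F.zero → x ; (F.suc _) → y }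
    unfold : ∀ a β u v → a * u + ((- β) * v + 0ℤ) ≡ a * u - β * v
    unfold = solve-∀

  independent-of-images : ∀ {q} (w : Fin q → Chain n) →
    Independent R q (λ i → f (w i)) → Independent C q w
  independent-of-images w ind d d·w≡0 = ind d λ τ _ →
    trans (sym (f-lincomb d w τ)) (trans (f-cong d·w≡0 τ) (f-zero τ))

  trivialKernel⇒torsionCokernel : length C ≡ length R → TrivialKernel → TorsionCokernel
  trivialKernel⇒torsionCokernel |C|≡|R| ker z noMultiple =
    ℕP.<-irrefl |C|≡|R| (independent⇒≤length R (suc m) v v-independent)
    where
    m = length C
    e : Fin m → Chain n
    e i = indicator (lookup C i)
    -- m + 1 vectors in ℤ^R, where |R| = m
    v : Fin (suc m) → Chain n
    v F.zero    = z
    v (F.suc i) = f (e i)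

    v-independent : Independent R (suc m) v
    v-independent c c·v≡0 = λ { F.zero → c₀≡0 ; (F.suc j) → cⱼ₊₁≡0 j }
      where
      c₊ : Fin m → ℤ
      c₊ i = c (F.suc i)
      x = lincomb c₊ e
      isolate : ∀ a s → a + s ≡ 0ℤ → a ≡ 0ℤ * s - 1ℤ * s
      isolate a s a+s≡0 = trans (reassoc a s) (trans (cong (_+ (0ℤ * s - 1ℤ * s)) a+s≡0) (ℤP.+-identityˡ _))
        where
        reassoc : ∀ a s → a ≡ (a + s) + (0ℤ * s - 1ℤ * s)
        reassoc = solve-∀
      c₀≡0 : c F.zero ≡ 0ℤ
      c₀≡0 = noMultiple (c F.zero) (λ σ → 0ℤ * x σ - 1ℤ * x σ) λ τ τ∈R → begin
        c F.zero * z τ                        ≡⟨ isolate (c F.zero * z τ) _ (c·v≡0 τ τ∈R) ⟩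
        0ℤ * lincomb c₊ (λ i → f (e i)) τ - 1ℤ * lincomb c₊ (λ i → f (e i)) τ
          ≡⟨ cong (λ t → 0ℤ * t - 1ℤ * t) (f-lincomb c₊ e τ) ⟨
        0ℤ * f x τ - 1ℤ * f x τ               ≡⟨ f-difference 0ℤ 1ℤ x x τ ⟨
        f (λ σ → 0ℤ * x σ - 1ℤ * x σ) τ       ∎
        where open ≡-Reasoning
      fx≡0 : EqOn R (f x) (λ _ → 0ℤ)
      fx≡0 τ τ∈R = begin
        f x τ                                      ≡⟨ f-lincomb c₊ e τ ⟩
        lincomb c₊ (λ i → f (e i)) τ               ≡⟨ ℤP.+-identityˡ _ ⟨
        0ℤ + lincomb c₊ (λ i → f (e i)) τ
          ≡⟨ cong (_+ lincomb c₊ (λ i → f (e i)) τ) (trans (cong (_* z τ) c₀≡0) (ℤP.*-zeroˡ (z τ))) ⟨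
        c F.zero * z τ + lincomb c₊ (λ i → f (e i)) τ ≡⟨ c·v≡0 τ τ∈R ⟩
        0ℤ                                         ∎
        where open ≡-Reasoning
      cⱼ₊₁≡0 : ∀ j → c₊ j ≡ 0ℤ
      cⱼ₊₁≡0 j = trans (sym (lincomb-indicators (lookup C) (lookup-injective C-unique) c₊ j))
                       (ker x fx≡0 (lookup C j) (∈-lookup j))

  record ScaledPreimage (τ : Subset n) : Set where
    constructor scaledPreimage
    field
      scale      : ℤ
      scale≢0    : scale ≢ 0ℤ
      preimage   : Chain n
      f-preimage : EqOn R (λ σ → scale * indicator τ σ) (f preimage)
  open ScaledPreimage

  scaledPreimages : TorsionCokernel → ∀ {q} (τ : Fin q → Subset n) →
    ¬ ¬ (∀ i → ScaledPreimage (τ i))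
  scaledPreimages tc {q} τ = ¬¬-finChoice q λ i noPreimage →
    tc (indicator (τ i)) λ a w a·τ≡fw →
      decidable-stable (a ℤ.≟ 0ℤ) (λ a≢0 → noPreimage (scaledPreimage a a≢0 w a·τ≡fw))

  torsionCokernel⇒trivialKernel : length C ≡ length R → TorsionCokernel → TrivialKernel
  torsionCokernel⇒trivialKernel |C|≡|R| tc x fx≡0 σ₀ σ₀∈C =
    decidable-stable (x σ₀ ℤ.≟ 0ℤ) λ xσ₀≢0 →
      scaledPreimages tc (lookup R) (tooManyIndependent xσ₀≢0 (∈-∃++ σ₀∈C))
    where
    p = length R
    -- The chains w′ i below vanish at σ₀ but are independent, so they do not fit in C ∖ {σ₀}.
    tooManyIndependent : x σ₀ ≢ 0ℤ →
      (∃ λ C₁ → ∃ λ C₂ → C ≡ C₁ ++ σ₀ ∷ C₂) → (∀ i → ScaledPreimage (lookup R i)) → ⊥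
    tooManyIndependent xσ₀≢0 (C₁ , C₂ , C≡) pre =
      ℕP.<-irrefl (sym |C₁++C₂|+1≡p) (s≤s (independent⇒≤length (C₁ ++ C₂) p w′ w′-independent))
      where
      a : Fin p → ℤ
      a i = scale (pre i)
      w : Fin p → Chain n
      w i = preimage (pre i)
      w′ : Fin p → Chain n
      w′ i σ = x σ₀ * w i σ - w i σ₀ * x σ

      fw′ : ∀ i → EqOn R (f (w′ i)) (λ τ → (x σ₀ * a i) * indicator (lookup R i) τ)
      fw′ i τ τ∈R = begin
        f (w′ i) τ
          ≡⟨ f-difference (x σ₀) (w i σ₀) (w i) x τ ⟩
        x σ₀ * f (w i) τ - w i σ₀ * f x τ
          ≡⟨ cong₂ (λ s t → x σ₀ * s - w i σ₀ * t) (sym (f-preimage (pre i) τ τ∈R)) (fx≡0 τ τ∈R) ⟩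
        x σ₀ * (a i * indicator (lookup R i) τ) - w i σ₀ * 0ℤ
          ≡⟨ simplify (x σ₀) (a i) _ (w i σ₀) ⟩
        (x σ₀ * a i) * indicator (lookup R i) τ ∎
        where
        open ≡-Reasoning
        simplify : ∀ x a u w → x * (a * u) - w * 0ℤ ≡ (x * a) * u
        simplify = solve-∀

      xσ₀aᵢ≢0 : ∀ i → x σ₀ * a i ≢ 0ℤ
      xσ₀aᵢ≢0 i xa≡0 =
        scale≢0 (pre i) (i*j≡0⇒i≡0 (a i) (x σ₀) (trans (ℤP.*-comm (a i) (x σ₀)) xa≡0) xσ₀≢0)

      w′-independent : Independent (C₁ ++ C₂) p w′
      w′-independent = independent-dropZeroRow C₁ C₂ (λ i → vanish (x σ₀) (w i σ₀))
        (subst (λ L → Independent L p w′) C≡ (independent-of-images w′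
          (scaledIndicators-independent R p (lookup R) (lookup-injective R-unique) ∈-lookup
            (λ i → x σ₀ * a i) xσ₀aᵢ≢0 (λ i → f (w′ i)) fw′)))
        where
        vanish : ∀ x w → x * w - w * x ≡ 0ℤ
        vanish = solve-∀

      |C₁++C₂|+1≡p : suc (length (C₁ ++ C₂)) ≡ p
      |C₁++C₂|+1≡p = trans (sym (LP.length-++-sucʳ C₁ σ₀ C₂)) (trans (cong length (sym C≡)) |C|≡|R|)

  torsionCokernel⇒rank≡length : TorsionCokernel → ∀ r →
    (Σ (Fin r → Chain n) λ w → Independent R r (λ i → f (w i))) →
    (∀ (w : Fin (suc r) → Chain n) → ¬ Independent R (suc r) (λ i → f (w i))) →
    r ≡ length R
  torsionCokernel⇒rank≡length tc r (w , independent) noneLarger =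
    ℕP.≤-antisym (independent⇒≤length R r _ independent) (ℕP.≮⇒≥ r≮|R|)
    where
    r≮|R| : ¬ r ℕ.< length R
    r≮|R| r<|R| = scaledPreimages tc τ λ pre →
      noneLarger (λ i → preimage (pre i))
        (scaledIndicators-independent R (suc r) τ τ-injective (λ i → ∈-lookup _)
          (λ i → scale (pre i)) (λ i → scale≢0 (pre i)) _ (λ i τ′ τ′∈R → sym (f-preimage (pre i) τ′ τ′∈R)))
      where
      τ : Fin (suc r) → Subset n
      τ i = lookup R (F.inject≤ i r<|R|)
      τ-injective : ∀ i j → τ i ≡ τ j → i ≡ j
      τ-injective i j τi≡τj =
        FP.inject≤-injective r<|R| r<|R| i j (lookup-injective R-unique _ _ τi≡τj)

allSubsets-unique : ∀ n → Unique (allSubsets n)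
allSubsets-unique zero    = All.[] ∷ []
allSubsets-unique (suc n) = UniqueP.++⁺ (UniqueP.map⁺ ∷-injectiveʳ (allSubsets-unique n))
                                       (UniqueP.map⁺ ∷-injectiveʳ (allSubsets-unique n)) disjoint
  where
  ∷-injectiveʳ : ∀ {b} {σ τ : Subset n} → b ∷ σ ≡ b ∷ τ → σ ≡ τ
  ∷-injectiveʳ e = proj₂ (∷-injective e)
  disjoint : ∀ {σ} → ¬ (σ ∈ map (false ∷_) (allSubsets n) × σ ∈ map (true ∷_) (allSubsets n))
  disjoint (σ∈₁ , σ∈₂) with ∈-map⁻ (false ∷_) σ∈₁ | ∈-map⁻ (true ∷_) σ∈₂
  ... | _ , _ , refl | _ , _ , ()

relFaces-unique : ∀ {n} (X Y : Family n) s → Unique (relFaces X Y s)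
relFaces-unique {n} X Y s = UniqueP.filter⁺ _ (allSubsets-unique n)

∧-guard-cong : ∀ x y x′ y′ g → (g ≡ true → x ∧ y ≡ x′ ∧ y′) → x ∧ y ∧ g ≡ x′ ∧ y′ ∧ g
∧-guard-cong x y x′ y′ g h =
  trans (sym (BoolP.∧-assoc x y g)) (trans (guarded g h) (BoolP.∧-assoc x′ y′ g))
  where
  guarded : ∀ g → (g ≡ true → x ∧ y ≡ x′ ∧ y′) → (x ∧ y) ∧ g ≡ (x′ ∧ y′) ∧ g
  guarded false _ = trans (BoolP.∧-zeroʳ (x ∧ y)) (sym (BoolP.∧-zeroʳ (x′ ∧ y′)))
  guarded true  h = trans (BoolP.∧-identityʳ (x ∧ y)) (trans (h refl) (sym (BoolP.∧-identityʳ (x′ ∧ y′))))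

relFaces-cong : ∀ {n} (X Y X′ Y′ : Family n) s →
  (∀ σ → ∣ σ ∣ ≡ s → X σ ∧ not (Y σ) ≡ X′ σ ∧ not (Y′ σ)) → relFaces X Y s ≡ relFaces X′ Y′ s
relFaces-cong {n} X Y X′ Y′ s h =
  LP.filter-≐ _ _ ((λ e → trans (sym (same _)) e) , (λ e → trans (same _) e)) (allSubsets n)
  where
  same : ∀ σ → X σ ∧ not (Y σ) ∧ (∣ σ ∣ ℕ.≡ᵇ s) ≡ X′ σ ∧ not (Y′ σ) ∧ (∣ σ ∣ ℕ.≡ᵇ s)
  same σ = ∧-guard-cong (X σ) (not (Y σ)) (X′ σ) (not (Y′ σ)) (∣ σ ∣ ℕ.≡ᵇ s)
    (λ e → h σ (ℕP.≡ᵇ⇒≡ ∣ σ ∣ s (subst T (sym e) _)))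

relFaces-empty : ∀ {n} (X Y : Family n) s →
  (∀ σ → ∣ σ ∣ ≡ s → X σ ∧ not (Y σ) ≡ false) → relFaces X Y s ≡ []
relFaces-empty {n} X Y s h =
  trans (relFaces-cong X Y (λ _ → false) (λ _ → false) s h)
        (LP.filter-none _ (All.universal (λ _ ()) (allSubsets n)))

bd-cong : ∀ {n} (X Y : Family n) s {x y : Chain n} → EqOn (relFaces X Y s) x y →
  ∀ τ → bd X Y s x τ ≡ bd X Y s y τ
bd-cong X Y s x≗y τ = sumList-cong (relFaces X Y s) (λ σ σ∈ → cong (inc τ σ *_) (x≗y σ σ∈))

bd-lincomb : ∀ {n} (X Y : Family n) s {b} (c : Fin b → ℤ) (z : Fin b → Chain n) τ →
  bd X Y s (lincomb c z) τ ≡ lincomb c (λ j → bd X Y s (z j)) τ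
bd-lincomb X Y s {b} c z τ = begin
  sumList L (λ σ → inc τ σ * sumFin b (λ j → c j * z j σ))
    ≡⟨ sumList-cong L (λ σ _ → trans (sym (sumFin-*ˡ b (inc τ σ) _))
         (sumFin-cong b (λ j → left-comm (inc τ σ) (c j) (z j σ)))) ⟩
  sumList L (λ σ → sumFin b (λ j → c j * (inc τ σ * z j σ)))
    ≡⟨ sumFin-sumList-comm b L (λ j σ → c j * (inc τ σ * z j σ)) ⟨
  sumFin b (λ j → sumList L (λ σ → c j * (inc τ σ * z j σ)))
    ≡⟨ sumFin-cong b (λ j → sumList-*ˡ L (c j) _) ⟩
  sumFin b (λ j → c j * bd X Y s (z j) τ) ∎
  where
  open ≡-Reasoning
  L = relFaces X Y s
  left-comm : ∀ a b c → a * (b * c) ≡ b * (a * c)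
  left-comm = solve-∀

bd-noFaces : ∀ {n} (X Y : Family n) s → relFaces X Y s ≡ [] → ∀ w τ → bd X Y s w τ ≡ 0ℤ
bd-noFaces X Y s noFaces w τ = cong (λ L → sumList L (λ σ → inc τ σ * w σ)) noFaces

bd-restrict : ∀ {n} {X Δ : Family n} (Y : Family n) s → (∀ σ → X σ ≡ true → Δ σ ≡ true) →
  ∀ w τ → bd Δ Y s (λ σ → if X σ then w σ else 0ℤ) τ ≡ bd X Y s w τ
bd-restrict {n} {X} {Δ} Y s X⊆Δ w τ =
  trans (sumList-filter _ _ (allSubsets n))
    (trans (sumList-cong (allSubsets n) (λ σ _ → termwise σ)) (sym (sumList-filter _ _ (allSubsets n))))
  where
  termwise : ∀ σ →
    (if Δ σ ∧ not (Y σ) ∧ (∣ σ ∣ ℕ.≡ᵇ s) then inc τ σ * (if X σ then w σ else 0ℤ) else 0ℤ)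
    ≡ (if X σ ∧ not (Y σ) ∧ (∣ σ ∣ ℕ.≡ᵇ s) then inc τ σ * w σ else 0ℤ)
  termwise σ with X σ in Xσ
  ... | true rewrite X⊆Δ σ Xσ = refl
  ... | false with Δ σ ∧ not (Y σ) ∧ (∣ σ ∣ ℕ.≡ᵇ s)
  ...   | true  = ℤP.*-zeroʳ (inc τ σ)
  ...   | false = refl

-- ∂^{X/Y} from the (s+1)-element faces to the s-element faces of X ∖ Y.
module Boundary {n} (X Y : Family n) (s : ℕ) =
  LinearMap (relFaces X Y (suc s)) (relFaces X Y s) (relFaces-unique X Y (suc s)) (relFaces-unique X Y s)
    (bd X Y (suc s)) (bd-cong X Y (suc s)) (bd-lincomb X Y (suc s))

hasBetti0⇒torsionCokernel : ∀ {n} (Z Y : Family n) s → rowFaces Z Y s ≡ [] →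
  HasBetti Z Y s 0 → Boundary.TorsionCokernel Z Y s
hasBetti0⇒torsionCokernel Z Y s noRows (_ , noCycle) z noMultiple =
  noCycle (λ _ → z) (λ _ σ σ∈ → noRow (subst (σ ∈_) noRows σ∈)) λ c w c·z≡∂w → λ
    { F.zero → noMultiple (c F.zero) w (λ σ σ∈ → trans (sym (ℤP.+-identityʳ _)) (c·z≡∂w σ σ∈)) }
  where
  noRow : ∀ {σ} {A : Set} → σ ∈ [] → A
  noRow ()

torsionCokernel⇒hasBetti0 : ∀ {n} (Z Y : Family n) s →
  Boundary.TorsionCokernel Z Y s → HasBetti Z Y s 0
torsionCokernel⇒hasBetti0 Z Y s tc = ((λ ()) , (λ ()) , (λ _ _ _ ())) , λ z _ ind →
  tc (z F.zero) λ c w c·z≡∂w → ind (λ _ → c) w (λ σ σ∈ → trans (ℤP.+-identityʳ _) (c·z≡∂w σ σ∈)) F.zero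

hasBetti0⇒trivialKernel : ∀ {n} (Z Y : Family n) s → relFaces Z Y (suc (suc s)) ≡ [] →
  HasBetti Z Y (suc s) 0 → Boundary.TrivialKernel Z Y s
hasBetti0⇒trivialKernel Z Y s noFacesAbove (_ , noCycle) x ∂x≡0 σ σ∈ =
  decidable-stable (x σ ℤ.≟ 0ℤ) λ xσ≢0 → noCycle (λ _ → x) (λ _ → ∂x≡0) λ c w c·x≡∂w → λ
    { F.zero → i*j≡0⇒i≡0 (c F.zero) (x σ)
        (trans (sym (ℤP.+-identityʳ _)) (trans (c·x≡∂w σ σ∈) (bd-noFaces Z Y _ noFacesAbove w σ))) xσ≢0 }

trivialKernel⇒hasBetti0 : ∀ {n} (Z Y : Family n) s → relFaces Z Y (suc (suc s)) ≡ [] →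
  Boundary.TrivialKernel Z Y s → HasBetti Z Y (suc s) 0
trivialKernel⇒hasBetti0 Z Y s noFacesAbove ker = ((λ ()) , (λ ()) , (λ _ _ _ ())) , λ z cyc ind →
  1≢0 (ind (λ _ → 1ℤ) (λ _ → 0ℤ) (λ σ σ∈ → begin
    1ℤ * z F.zero σ + 0ℤ                  ≡⟨ cong (λ t → 1ℤ * t + 0ℤ) (ker (z F.zero) (cyc F.zero) σ σ∈) ⟩
    0ℤ                                    ≡⟨ bd-noFaces Z Y _ noFacesAbove (λ _ → 0ℤ) σ ⟨
    bd Z Y (suc (suc s)) (λ _ → 0ℤ) σ     ∎) F.zero)
  where
  open ≡-Reasoning
  1≢0 : 1ℤ ≢ 0ℤ
  1≢0 ()

hasBetti-unique0 : ∀ {n} (Z Y : Family n) s b → HasBetti Z Y s b → HasBetti Z Y s 0 → b ≡ 0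
hasBetti-unique0 Z Y s zero    _                  _               = refl
hasBetti-unique0 Z Y s (suc b) ((z , cyc , ind) , _) (_ , noCycle) =
  ⊥-elim (noCycle (λ _ → z F.zero) (λ _ → cyc F.zero) λ c w c·z≡∂w → λ
    { F.zero → ind (λ { F.zero → c F.zero ; (F.suc _) → 0ℤ }) w (λ σ σ∈ →
        trans (cong (c F.zero * z F.zero σ +_) (sumFin-zero b (λ j → ℤP.*-zeroˡ (z (F.suc j) σ))))
              (c·z≡∂w σ σ∈)) F.zero })

AtLeastTwo-map : ∀ {P Q R P′ Q′ R′ : Set} → (P → P′) → (Q → Q′) → (R → R′) →
  AtLeastTwo P Q R → AtLeastTwo P′ Q′ R′
AtLeastTwo-map f g h (inj₁ (p , q))         = inj₁ (f p , g q)
AtLeastTwo-map f g h (inj₂ (inj₁ (p , r)))  = inj₂ (inj₁ (f p , h r))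
AtLeastTwo-map f g h (inj₂ (inj₂ (q , r)))  = inj₂ (inj₂ (g q , h r))

-- Below the k-element faces, Y contains every face of Δ, so ∂^{Z/Y} has no rows there.
noRowsBelow : ∀ {n} k {Δ Z Y : Family n} → InC k Δ Y → (∀ σ → Z σ ≡ true → Δ σ ≡ true) →
  rowFaces Z Y k ≡ []
noRowsBelow zero    hY Z⊆Δ = refl
noRowsBelow (suc k) {Z = Z} {Y} hY Z⊆Δ = relFaces-empty Z Y k noFace
  where
  noFace : ∀ σ → ∣ σ ∣ ≡ k → Z σ ∧ not (Y σ) ≡ false
  noFace σ |σ|≡k with Z σ in Zσ
  ... | false = refl
  ... | true rewrite proj₁ (hY σ) (Z⊆Δ σ Zσ) (ℕP.≤-reflexive (cong suc |σ|≡k)) = refl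

module RootPair {n} (k : ℕ) (Δ X Y : Family n) (hX : InC (suc k) Δ X) (hY : InC k Δ Y) where

  X⊆Δ : ∀ σ → X σ ≡ true → Δ σ ≡ true
  X⊆Δ σ Xσ = proj₁ (proj₂ (hX σ) Xσ)

  falseAbove : ∀ (Z : Family n) {t} σ → (Z σ ≡ true → ∣ σ ∣ ≤ t) → ∣ σ ∣ ≡ suc t → Z σ ≡ false
  falseAbove Z σ bound |σ|≡t+1 =
    BoolP.¬-not λ Zσ → ℕP.<-irrefl refl (subst (_≤ _) |σ|≡t+1 (bound Zσ))

  Y-above : ∀ σ → ∣ σ ∣ ≡ suc k → Y σ ≡ false
  Y-above σ = falseAbove Y σ (λ Yσ → proj₂ (proj₂ (hY σ) Yσ))

  rows≡ : relFaces X Y k ≡ relFaces Δ Y k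
  rows≡ = relFaces-cong X Y Δ Y k λ σ |σ|≡k → cong (_∧ not (Y σ)) (BoolP.⇔→≡ (mk⇔ (X⊆Δ σ)
    (λ Δσ → proj₁ (hX σ) Δσ (ℕP.≤-reflexive (cong suc |σ|≡k)))))

  columns≡ : relFaces X Y (suc k) ≡ faces X (suc k)
  columns≡ = relFaces-cong X Y X (λ _ → false) (suc k) λ σ |σ|≡k+1 →
    cong (λ b → X σ ∧ not b) (Y-above σ |σ|≡k+1)

  noFacesY : faces Y (suc k) ≡ []
  noFacesY = relFaces-empty Y (λ _ → false) (suc k) λ σ |σ|≡k+1 → cong (_∧ true) (Y-above σ |σ|≡k+1)

  noFacesAboveX : relFaces X Y (suc (suc k)) ≡ []
  noFacesAboveX = relFaces-empty X Y (suc (suc k)) λ σ |σ|≡k+2 →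
    cong (_∧ not (Y σ)) (falseAbove X σ (λ Xσ → proj₂ (proj₂ (hX σ) Xσ)) |σ|≡k+2)

  Y∈C[X] : InC k X Y
  Y∈C[X] σ = (λ Xσ → proj₁ (hY σ) (X⊆Δ σ Xσ)) ,
             (λ Yσ → proj₁ (hX σ) (proj₁ (proj₂ (hY σ) Yσ)) (s≤s (proj₂ (proj₂ (hY σ) Yσ))) ,
                     proj₂ (proj₂ (hY σ) Yσ))

  Square : Set
  Square = length (faces X (suc k)) ≡ length (relFaces X Y k)

  square⇒|C|≡|R| : Square → length (relFaces X Y (suc k)) ≡ length (relFaces X Y k)
  square⇒|C|≡|R| square = trans (cong length columns≡) square

  torsionCokernel⇒torsionCokernelΔ : Boundary.TorsionCokernel X Y k → Boundary.TorsionCokernel Δ Y k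
  torsionCokernel⇒torsionCokernelΔ tc z noMultipleΔ = tc z λ c w c·z≡∂w →
    noMultipleΔ c (λ σ → if X σ then w σ else 0ℤ) λ σ σ∈ →
      trans (c·z≡∂w σ (subst (σ ∈_) (sym rows≡) σ∈)) (sym (bd-restrict Y (suc k) X⊆Δ w σ))

  betti⇒bettiΔ : HasBetti X Y k 0 → HasBetti Δ Y k 0
  betti⇒bettiΔ βX = torsionCokernel⇒hasBetti0 Δ Y k (torsionCokernel⇒torsionCokernelΔ
    (hasBetti0⇒torsionCokernel X Y k (noRowsBelow k hY X⊆Δ) βX))

  bettiΔ⇒betti : HasBetti Δ Y k 0 → (∃ λ b → HasBetti X Y k b × HasBetti Δ Y k b) → HasBetti X Y k 0
  bettiΔ⇒betti βΔ (b , βX , βΔ′) = subst (HasBetti X Y k) (hasBetti-unique0 Δ Y k b βΔ′ βΔ) βX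

  rank⇒square : HasBetti Δ Y k 0 →
    (∃ λ r → HasRank Δ Y (suc k) r × (length (faces X (suc k)) ≡ length (faces Y (suc k)) ℕ.+ r)) →
    Square
  rank⇒square βΔ (r , (independent , noneLarger) , |X|≡|Y|+r) = begin
    length (faces X (suc k))        ≡⟨ |X|≡|Y|+r ⟩
    length (faces Y (suc k)) ℕ.+ r  ≡⟨ cong (λ L → length L ℕ.+ r) noFacesY ⟩
    r                               ≡⟨ Boundary.torsionCokernel⇒rank≡length Δ Y k tcΔ r
                                         independent noneLarger ⟩
    length (relFaces Δ Y k)         ≡⟨ cong length rows≡ ⟨
    length (relFaces X Y k)         ∎
    where
    open ≡-Reasoning
    tcΔ = hasBetti0⇒torsionCokernel Δ Y k (noRowsBelow k hY (λ _ Δσ → Δσ)) βΔ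

  -- When square, ∂ is injective iff its cokernel is torsion.
  bothBettiVanish : AtLeastTwo Square (HasBetti X Y k 0) (HasBetti X Y (suc k) 0) →
    HasBetti X Y k 0 × HasBetti X Y (suc k) 0
  bothBettiVanish (inj₁ (square , β₀)) =
    β₀ , trivialKernel⇒hasBetti0 X Y k noFacesAboveX
           (Boundary.torsionCokernel⇒trivialKernel X Y k (square⇒|C|≡|R| square)
             (hasBetti0⇒torsionCokernel X Y k (noRowsBelow k hY X⊆Δ) β₀))
  bothBettiVanish (inj₂ (inj₁ (square , β₁))) =
    torsionCokernel⇒hasBetti0 X Y k
      (Boundary.trivialKernel⇒torsionCokernel X Y k (square⇒|C|≡|R| square)
        (hasBetti0⇒trivialKernel X Y k noFacesAboveX β₁)) , β₁
  bothBettiVanish (inj₂ (inj₂ β₀β₁)) = β₀β₁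

corollary2p10 : (n k : ℕ) (Δ : Family n) → IsSimplicialComplex Δ →
    (X Y : Family n) →
    Froot k Δ X Y ⇔
      (Frel k Δ X Y × InC (suc k) Δ X × InC k Δ Y × HasBetti Δ Y k 0)
corollary2p10 n k Δ _ X Y = mk⇔ toRel fromRel
  where
  toRel : Froot k Δ X Y → Frel k Δ X Y × InC (suc k) Δ X × InC k Δ Y × HasBetti Δ Y k 0
  toRel (hX , hY , two) =
    (hX , (k , Y∈C[X]) , inj₂ (inj₂ ((0 , β₀ , betti⇒bettiΔ β₀) , β₁))) , hX , hY , betti⇒bettiΔ β₀
    where
    open RootPair k Δ X Y hX hY
    β₀ = proj₁ (bothBettiVanish two)
    β₁ = proj₂ (bothBettiVanish two)

  fromRel : Frel k Δ X Y × InC (suc k) Δ X × InC k Δ Y × HasBetti Δ Y k 0 → Froot k Δ X Y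
  fromRel ((_ , _ , two) , hX , hY , βΔ) =
    hX , hY , AtLeastTwo-map (rank⇒square βΔ) (bettiΔ⇒betti βΔ) (λ β₁ → β₁) two
    where open RootPair k Δ X Y hX hY
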